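{- Let $r \geq 0$, let $n_0, n_1, \dots, n_{r+1}$ be integers with $n_1, \dots, n_r \neq 0$, let $\varepsilon \in \{1,-1\}$, and let $$A = \begin{pmatrix} a & b \\ c & d\end{pmatrix} = \varepsilon\, T^{2n_0} S T^{2n_1} S \cdots T^{2n_r} S T^{2n_{r+1}},$$ where $T = \begin{pmatrix} 1 & 1 \\ 0 & 1\end{pmatrix}$ and $S = \begin{pmatrix} 0 & -1 \\ 1 & 0\end{pmatrix}$. Then $a/c \in (-1,1)$ if and only if $n_0 = 0$ (where $a/c$ is read as $\infty \notin (-1,1)$ if $c = 0$).
   Context: Here $T^{2n_0} S T^{2n_1} S \cdots T^{2n_r} S T^{2n_{r+1}}$ denotes the product of $r+1$ factors $T^{2n_i}S$ ($i=0,\dots,r$) followed by $T^{2n_{r+1}}$; for $r=0$ it is $T^{2n_0} S T^{2n_1}$. -}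

module Defs where

open import Data.Integer using (ℤ; +_; -[1+_]; _+_; _*_; -_; _<_; ∣_∣; 0ℤ; 1ℤ)
open import Data.Nat using (ℕ; zero; suc)
open import Data.List using (List; []; _∷_)
open import Data.Product using (_×_)
open import Relation.Nullary using (¬_)
open import Relation.Binary.PropositionalEquality using (_≡_)

record M2 : Set where
  constructor mat
  field
    a b c d : ℤ

open M2 public

_⊗_ : M2 → M2 → M2
mat a₁ b₁ c₁ d₁ ⊗ mat a₂ b₂ c₂ d₂ =
  mat (a₁ * a₂ + b₁ * c₂) (a₁ * b₂ + b₁ * d₂)
      (c₁ * a₂ + d₁ * c₂) (c₁ * b₂ + d₁ * d₂)
infixl 7 _⊗_

I₂ : M2
I₂ = mat 1ℤ 0ℤ 0ℤ 1ℤ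

T : M2
T = mat 1ℤ 1ℤ 0ℤ 1ℤ

T⁻¹ : M2
T⁻¹ = mat 1ℤ (- 1ℤ) 0ℤ 1ℤ

S : M2
S = mat 0ℤ (- 1ℤ) 1ℤ 0ℤ

_^ᴹ_ : M2 → ℕ → M2
M ^ᴹ zero = I₂
M ^ᴹ suc k = M ⊗ (M ^ᴹ k)

Tpow : ℤ → M2
Tpow (+ k) = T ^ᴹ k
Tpow -[1+ k ] = T⁻¹ ^ᴹ suc k

_·ᴹ_ : ℤ → M2 → M2
e ·ᴹ mat a b c d = mat (e * a) (e * b) (e * c) (e * d)

-- word n₀ [n₁ … n_r] n_{r+1}  =  T^{2n₀} S T^{2n₁} S ⋯ T^{2n_r} S T^{2n_{r+1}}
word : ℤ → List ℤ → ℤ → M2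
word n₀ [] last = Tpow (+ 2 * n₀) ⊗ S ⊗ Tpow (+ 2 * last)
word n₀ (n₁ ∷ ns) last = Tpow (+ 2 * n₀) ⊗ S ⊗ word n₁ ns last

data AllNonzero : List ℤ → Set where
  []  : AllNonzero []
  _∷_ : ∀ {x xs} → ¬ (x ≡ 0ℤ) → AllNonzero xs → AllNonzero (x ∷ xs)

-- a/c ∈ (-1,1), with a/c = ∞ ∉ (-1,1) when c = 0:  c ≠ 0 and |a| < |c|
RatioInUnitInterval : M2 → Set
RatioInUnitInterval M = ¬ (c M ≡ 0ℤ) × (Data.Nat._<_ ∣ a M ∣ ∣ c M ∣)
  where import Data.Nat

-- Write A = ε T^{2n₀} S W, where W is the rest of the word. Left multiplication by T^k S sends the
-- first column (p, s) of W to (k p − s, p). A last factor T^{2m} has first column (1, 0), and each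
-- further factor T^{2n} S with n ≠ 0 keeps the first column strictly dominated by its top entry,
-- since |2n p − s| ≥ 2|p| − |s| > |p| whenever |s| < |p|. So W has |c| < |a|, and A has first column
-- ±(2n₀ p − s, p): for n₀ = 0 this is ±(−s, p) with |s| < |p|, otherwise |2n₀ p − s| > |p|.
module Submission where

open import Defs
open import Data.Integer using (ℤ; 1ℤ; -_; 0ℤ; +_; -[1+_]; _+_; _*_; _-_; ∣_∣; _≟_)
open import Data.Integer.Properties
  using (∣-i∣≡∣i∣; ∣i+j∣≤∣i∣+∣j∣; abs-*; ∣i∣≡0⇒i≡0; *-identityˡ; -1*i≡-i; +-identityˡ)
open import Data.Integer.Tactic.RingSolver using (solve-∀)
open import Data.Nat as ℕ using (zero; suc; z≤n; s≤s)
import Data.Nat.Properties as ℕ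
open import Data.List using (List; []; _∷_)
open import Data.Sum using (_⊎_; inj₁; inj₂)
open import Data.Product using (_,_)
open import Relation.Binary.PropositionalEquality
open import Relation.Nullary using (¬_; yes; no; contradiction)
open import Function.Bundles using (_⇔_; mk⇔; Equivalence)

mat-cong : ∀ {a b c d a′ b′ c′ d′} →
           a ≡ a′ → b ≡ b′ → c ≡ c′ → d ≡ d′ → mat a b c d ≡ mat a′ b′ c′ d′
mat-cong refl refl refl refl = refl

T^ᴹ≡ : ∀ n → T ^ᴹ n ≡ mat 1ℤ (+ n) 0ℤ 1ℤ
T^ᴹ≡ zero = refl
T^ᴹ≡ (suc n) rewrite T^ᴹ≡ n = mat-cong refl (b-entry (+ n)) refl refl
  where
  b-entry : ∀ x → 1ℤ * x + 1ℤ * 1ℤ ≡ 1ℤ + x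
  b-entry = solve-∀

T⁻¹^ᴹ≡ : ∀ n → T⁻¹ ^ᴹ n ≡ mat 1ℤ (- (+ n)) 0ℤ 1ℤ
T⁻¹^ᴹ≡ zero = refl
T⁻¹^ᴹ≡ (suc n) rewrite T⁻¹^ᴹ≡ n = mat-cong refl (b-entry (+ n)) refl refl
  where
  b-entry : ∀ x → 1ℤ * (- x) + (- 1ℤ) * 1ℤ ≡ - (1ℤ + x)
  b-entry = solve-∀

Tpow≡ : ∀ k → Tpow k ≡ mat 1ℤ k 0ℤ 1ℤ
Tpow≡ (+ n)    = T^ᴹ≡ n
Tpow≡ -[1+ n ] = T⁻¹^ᴹ≡ (suc n)

a-Tpow-S-⊗ : ∀ k W → a (Tpow k ⊗ S ⊗ W) ≡ k * a W - c W
a-Tpow-S-⊗ k (mat p q s t) rewrite Tpow≡ k = a-entry k p s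
  where
  a-entry : ∀ k p s → (1ℤ * 0ℤ + k * 1ℤ) * p + (1ℤ * (- 1ℤ) + k * 0ℤ) * s ≡ k * p - s
  a-entry = solve-∀

c-Tpow-S-⊗ : ∀ k W → c (Tpow k ⊗ S ⊗ W) ≡ a W
c-Tpow-S-⊗ k (mat p q s t) rewrite Tpow≡ k = c-entry p s
  where
  c-entry : ∀ p s → (0ℤ * 0ℤ + 1ℤ * 1ℤ) * p + (0ℤ * (- 1ℤ) + 1ℤ * 0ℤ) * s ≡ p
  c-entry = solve-∀

TopDominant : M2 → Set
TopDominant W = ∣ c W ∣ ℕ.< ∣ a W ∣

∣k*p-s∣>∣p∣ : ∀ k p s → 2 ℕ.≤ ∣ k ∣ → ∣ s ∣ ℕ.< ∣ p ∣ → ∣ p ∣ ℕ.< ∣ k * p - s ∣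
∣k*p-s∣>∣p∣ k p s 2≤∣k∣ ∣s∣<∣p∣ = ℕ.+-cancelʳ-< _ _ _ (begin-strict
  ∣ p ∣ ℕ.+ ∣ s ∣               <⟨ ℕ.+-monoʳ-< ∣ p ∣ ∣s∣<∣p∣ ⟩
  ∣ p ∣ ℕ.+ ∣ p ∣               ≡⟨ cong (∣ p ∣ ℕ.+_) (sym (ℕ.+-identityʳ ∣ p ∣)) ⟩
  2 ℕ.* ∣ p ∣                   ≤⟨ ℕ.*-monoˡ-≤ ∣ p ∣ 2≤∣k∣ ⟩
  ∣ k ∣ ℕ.* ∣ p ∣               ≡⟨ abs-* k p ⟨
  ∣ k * p ∣                     ≡⟨ cong ∣_∣ (sub-add (k * p) s) ⟨
  ∣ (k * p - s) + s ∣           ≤⟨ ∣i+j∣≤∣i∣+∣j∣ (k * p - s) s ⟩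
  ∣ k * p - s ∣ ℕ.+ ∣ s ∣       ∎)
  where
  open ℕ.≤-Reasoning
  sub-add : ∀ x y → (x - y) + y ≡ x
  sub-add = solve-∀

2≤∣2*n∣ : ∀ n → ¬ n ≡ 0ℤ → 2 ℕ.≤ ∣ + 2 * n ∣
2≤∣2*n∣ n n≢0 = subst (2 ℕ.≤_) (sym (abs-* (+ 2) n))
  (ℕ.*-monoʳ-≤ 2 (ℕ.n≢0⇒n>0 (λ ∣n∣≡0 → n≢0 (∣i∣≡0⇒i≡0 ∣n∣≡0))))

TopDominant-Tpow-S-⊗ : ∀ n W → ¬ n ≡ 0ℤ → TopDominant W → TopDominant (Tpow (+ 2 * n) ⊗ S ⊗ W)
TopDominant-Tpow-S-⊗ n W n≢0 dom
  rewrite a-Tpow-S-⊗ (+ 2 * n) W | c-Tpow-S-⊗ (+ 2 * n) W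
  = ∣k*p-s∣>∣p∣ (+ 2 * n) (a W) (c W) (2≤∣2*n∣ n n≢0) dom

wordTail : List ℤ → ℤ → M2
wordTail []        nlast = Tpow (+ 2 * nlast)
wordTail (n ∷ ns)  nlast = word n ns nlast

word≡ : ∀ n₀ ns nlast → word n₀ ns nlast ≡ Tpow (+ 2 * n₀) ⊗ S ⊗ wordTail ns nlast
word≡ n₀ []       nlast = refl
word≡ n₀ (n ∷ ns) nlast = refl

TopDominant-wordTail : ∀ ns nlast → AllNonzero ns → TopDominant (wordTail ns nlast)
TopDominant-wordTail []       nlast []         rewrite Tpow≡ (+ 2 * nlast) = s≤s z≤n
TopDominant-wordTail (n ∷ ns) nlast (n≢0 ∷ hs) =
  subst TopDominant (sym (word≡ n ns nlast))
    (TopDominant-Tpow-S-⊗ n (wordTail ns nlast) n≢0 (TopDominant-wordTail ns nlast hs))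

∣±1*x∣≡∣x∣ : ∀ {ε} x → ε ≡ 1ℤ ⊎ ε ≡ - 1ℤ → ∣ ε * x ∣ ≡ ∣ x ∣
∣±1*x∣≡∣x∣ x (inj₁ refl) = cong ∣_∣ (*-identityˡ x)
∣±1*x∣≡∣x∣ x (inj₂ refl) = trans (cong ∣_∣ (-1*i≡-i x)) (∣-i∣≡∣i∣ x)

RatioInUnitInterval-±1·ᴹ⇔ : ∀ {ε} M → ε ≡ 1ℤ ⊎ ε ≡ - 1ℤ →
                            RatioInUnitInterval (ε ·ᴹ M) ⇔ ∣ a M ∣ ℕ.< ∣ c M ∣
RatioInUnitInterval-±1·ᴹ⇔ {ε} M ±1 = mk⇔
  (λ (_ , lt) → subst₂ ℕ._<_ (∣±1*x∣≡∣x∣ (a M) ±1) (∣±1*x∣≡∣x∣ (c M) ±1) lt)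
  (λ lt → (λ c≡0 → ℕ.n≮0 (subst (∣ ε * a M ∣ ℕ.<_) (cong ∣_∣ c≡0) (lt′ lt))) , lt′ lt)
  where
  lt′ : ∣ a M ∣ ℕ.< ∣ c M ∣ → ∣ ε * a M ∣ ℕ.< ∣ ε * c M ∣
  lt′ = subst₂ ℕ._<_ (sym (∣±1*x∣≡∣x∣ (a M) ±1)) (sym (∣±1*x∣≡∣x∣ (c M) ±1))

lemma7 : (n₀ : ℤ) (ns : List ℤ) (nlast : ℤ) → AllNonzero ns →
    (ε : ℤ) → (ε ≡ 1ℤ ⊎ ε ≡ - 1ℤ) →
    (RatioInUnitInterval (ε ·ᴹ word n₀ ns nlast) ⇔ (n₀ ≡ 0ℤ))
lemma7 n₀ ns nlast hs ε ±1 rewrite word≡ n₀ ns nlast = mk⇔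
  (λ ratio → n₀≡0 (Equivalence.to (RatioInUnitInterval-±1·ᴹ⇔ A ±1) ratio))
  (λ { refl → Equivalence.from (RatioInUnitInterval-±1·ᴹ⇔ A ±1) ∣a∣<∣c∣ })
  where
  W = wordTail ns nlast
  A = Tpow (+ 2 * n₀) ⊗ S ⊗ W
  dom : TopDominant W
  dom = TopDominant-wordTail ns nlast hs
  ∣a∣≡ : ∣ a A ∣ ≡ ∣ + 2 * n₀ * a W - c W ∣
  ∣a∣≡ = cong ∣_∣ (a-Tpow-S-⊗ (+ 2 * n₀) W)
  ∣c∣≡ : ∣ c A ∣ ≡ ∣ a W ∣
  ∣c∣≡ = cong ∣_∣ (c-Tpow-S-⊗ (+ 2 * n₀) W)
  n₀≡0 : ∣ a A ∣ ℕ.< ∣ c A ∣ → n₀ ≡ 0ℤ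
  n₀≡0 lt with n₀ ≟ 0ℤ
  ... | yes n₀≡0 = n₀≡0
  ... | no  n₀≢0 = contradiction (subst₂ ℕ._<_ ∣a∣≡ ∣c∣≡ lt)
                     (ℕ.<-asym (∣k*p-s∣>∣p∣ (+ 2 * n₀) (a W) (c W) (2≤∣2*n∣ n₀ n₀≢0) dom))
  ∣a∣<∣c∣ : ∣ a (Tpow 0ℤ ⊗ S ⊗ W) ∣ ℕ.< ∣ c (Tpow 0ℤ ⊗ S ⊗ W) ∣
  ∣a∣<∣c∣ rewrite a-Tpow-S-⊗ 0ℤ W | c-Tpow-S-⊗ 0ℤ W | +-identityˡ (- c W) | ∣-i∣≡∣i∣ (c W) = dom
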